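{- Let $a,k$ be positive integers with $a$ odd. Then for every positive integer $n$, $$t(a,a,8a,2k;\,2n)=t(a,2a,2a,k;\,n)\qquad\text{and}\qquad t(a,a,8a,2k;\,2n+a)=2\,t(a,4a,4a,k;\,n).$$
   Context: For positive integers $a,b,c,d$ and an integer $n\ge 0$, $t(a,b,c,d;n)$ denotes the number of $(x,y,z,w)\in\mathbb Z^4$ with $n=a\frac{x(x-1)}2+b\frac{y(y-1)}2+c\frac{z(z-1)}2+d\frac{w(w-1)}2$. -}

module Defs where

open import Data.Nat as ℕ using (ℕ; suc)
open import Data.Integer as ℤ using (ℤ; +_; -[1+_]; _-_; _*_; _+_)
open import Data.Integer.DivMod using (_/ℕ_)
open import Data.Integer.Properties using (_≟_)
open import Data.List using (List; []; _∷_; length; filter; cartesianProduct; map; upTo)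
open import Data.List using (_++_; reverse)
open import Data.Product using (_×_; _,_)
open import Relation.Binary.PropositionalEquality using (_≡_)
open import Relation.Nullary using (Dec)

-- generalized triangular number x(x-1)/2 for x ∈ ℤ (the division is exact)
tri : ℤ → ℤ
tri x = (x * (x - + 1)) /ℕ 2

form : ℕ → ℕ → ℕ → ℕ → ℤ × ℤ × ℤ × ℤ → ℤ
form a b c d (x , y , z , w) =
  + a * tri x + + b * tri y + + c * tri z + + d * tri w

range : ℕ → List ℤ
range N = map (λ i → -[1+ i ]) (upTo N) ++ map +_ (upTo (suc N))

box : ℕ → List (ℤ × ℤ × ℤ × ℤ)
box N = cartesianProduct (range N)
          (cartesianProduct (range N) (cartesianProduct (range N) (range N)))

-- t(a,b,c,d;n) = #{(x,y,z,w) ∈ ℤ^4 : n = a x(x-1)/2 + ... + d w(w-1)/2}.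
-- For positive a,b,c,d every solution satisfies |x|,|y|,|z|,|w| ≤ n+1
-- (since x(x-1)/2 ≥ |x| - 1), so counting solutions in the box
-- [-(n+1), n+1]^4 counts all of them.
t : ℕ → ℕ → ℕ → ℕ → ℕ → ℕ
t a b c d n = length (filter (λ v → form a b c d v ≟ + n) (box (suc n)))

module Submission where

-- Write T(x) = x(x-1)/2 and L = a T(x) + a T(y) + 8a T(z) + 2k T(w). The substitution y ↦ 1 - y
-- fixes T(y) and changes the parity of x + y, so exactly half of the representations of any m by L
-- have x + y even; likewise exactly half of the representations of n by a T(X) + 2a T(Y) + 2a T(Z) + k T(W)
-- have Y + Z even. When x + y = 2s, put d = x - s: then (x, y) = (s + d, s - d) and
-- T(s + d) + T(s - d) = 2 T(s) + d², so L ≡ a d² ≡ d (mod 2) because a is odd.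
--   * If L = 2n, then d = 2e, and T(z + e) + T(z - e) = 2 T(z) + e² shows that (s, z + e, z - e, w)
--     represents n by (a, 2a, 2a, k), with Y + Z = 2z even.
--   * If L = 2n + a, then d = 2Y - 1, and d² = 8 T(Y) + 1 shows that (s, Y, z, w) represents n
--     by (a, 4a, 4a, k).
-- Both maps are linear changes of variables with explicit inverses, hence bijections.

open import Level using (0ℓ)
open import Data.Empty using (⊥-elim)
open import Data.Product using (∃; ∃₂; _×_; _,_; proj₁; proj₂)
open import Data.List using (List; []; _∷_; length; filter; map)
open import Data.List.Membership.Propositional using (_∈_)
open import Data.List.Relation.Unary.Unique.Propositional using (Unique)
open import Function using (_∘_; id; mk⇔)
open import Relation.Nullary using (¬_; yes; no)
open import Relation.Unary using (Pred; Decidable; _⊆_; _∩_; ∁)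
open import Relation.Unary.Properties using (_∩?_; ∁?)
open import Relation.Binary.PropositionalEquality
open ≡-Reasoning
open import Defs
open import Data.Nat.Base using (ℕ; NonZero)
import Data.Integer.Base as ℤ

module Counting where
  open import Data.Nat.Base using (ℕ; suc; _+_; _*_)
  open import Data.Nat.Properties using (+-suc; +-identityʳ)
  open import Data.List.Properties using (length-map; map-∘; map-id-local)
  open import Data.List.Membership.Propositional.Properties using (∈-filter⁺; ∈-filter⁻; ∈-map⁺; ∈-map⁻)
  open import Data.List.Membership.Propositional.Properties.WithK using (unique∧set⇒bag)
  open import Data.List.Relation.Binary.BagAndSetEquality using (∼bag⇒↭)
  open import Data.List.Relation.Binary.Permutation.Propositional.Properties using (↭-length)
  import Data.List.Relation.Unary.All as All
  import Data.List.Relation.Unary.Unique.Propositional.Properties as Unique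

  record _⇿_ {A B : Set} (P : Pred A 0ℓ) (Q : Pred B 0ℓ) : Set where
    field
      to        : A → B
      from      : B → A
      to-pres   : P ⊆ Q ∘ to
      from-pres : Q ⊆ P ∘ from
      from∘to   : ∀ {x} → P x → from (to x) ≡ x
      to∘from   : ∀ {y} → Q y → to (from y) ≡ y

  module _ {A B : Set} {P : Pred A 0ℓ} {Q : Pred B 0ℓ} (P? : Decidable P) (Q? : Decidable Q) where

    length-filter-⇿ : ∀ {xs ys} → Unique xs → Unique ys → P ⊆ (_∈ xs) → Q ⊆ (_∈ ys) →
                      P ⇿ Q → length (filter P? xs) ≡ length (filter Q? ys)
    length-filter-⇿ {xs} {ys} xs! ys! P⊆xs Q⊆ys P⇿Q = begin
      length Ps             ≡⟨ length-map to Ps ⟨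
      length (map to Ps)    ≡⟨ ↭-length (∼bag⇒↭ (unique∧set⇒bag image! (Unique.filter⁺ Q? {ys} ys!)
                                                                 (mk⇔ into onto))) ⟩
      length (filter Q? ys) ∎
      where
      open _⇿_ P⇿Q
      Ps : List A
      Ps = filter P? xs
      from∘to-on-Ps : map from (map to Ps) ≡ Ps
      from∘to-on-Ps = trans (sym (map-∘ Ps))
                            (map-id-local (All.tabulate (from∘to ∘ proj₂ ∘ ∈-filter⁻ P? {xs = xs})))
      image! : Unique (map to Ps)
      image! = Unique.map⁻ {f = from} (subst Unique (sym from∘to-on-Ps) (Unique.filter⁺ P? {xs} xs!))
      into : ∀ {y} → y ∈ map to Ps → y ∈ filter Q? ys
      into y∈ with ∈-map⁻ to y∈
      ... | x , x∈Ps , refl = ∈-filter⁺ Q? (Q⊆ys Qy) Qy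
        where Qy = to-pres (proj₂ (∈-filter⁻ P? {xs = xs} x∈Ps))
      onto : ∀ {y} → y ∈ filter Q? ys → y ∈ map to Ps
      onto y∈ = subst (_∈ map to Ps) (to∘from Qy) (∈-map⁺ to (∈-filter⁺ P? (P⊆xs Px) Px))
        where
        Qy = proj₂ (∈-filter⁻ Q? {xs = ys} y∈)
        Px = from-pres Qy

  Flips : ∀ {A : Set} → (A → A) → Pred A 0ℓ → Set
  Flips ρ E = ∀ x → (E x → ¬ E (ρ x)) × (¬ E x → E (ρ x))

  module _ {A : Set} {P E : Pred A 0ℓ} (P? : Decidable P) (E? : Decidable E) where

    length-filter-split : ∀ xs → length (filter P? xs) ≡
                          length (filter (P? ∩? E?) xs) + length (filter (P? ∩? ∁? E?) xs)
    length-filter-split []       = refl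
    length-filter-split (x ∷ xs) with P? x | E? x
    ... | yes _ | yes _ = cong suc (length-filter-split xs)
    ... | yes _ | no _  = trans (cong suc (length-filter-split xs)) (sym (+-suc _ _))
    ... | no _  | _     = length-filter-split xs

    length-filter-halves : ∀ {xs} → Unique xs → P ⊆ (_∈ xs) →
                           (ρ : A → A) → (∀ x → ρ (ρ x) ≡ x) → P ⊆ P ∘ ρ → Flips ρ E →
                           length (filter P? xs) ≡ 2 * length (filter (P? ∩? E?) xs)
    length-filter-halves {xs} xs! P⊆xs ρ ρ∘ρ P-ρ ρ-flips = begin
      length (filter P? xs)                  ≡⟨ length-filter-split xs ⟩
      m + length (filter (P? ∩? ∁? E?) xs)   ≡⟨ cong (m +_) (length-filter-⇿ (P? ∩? ∁? E?) (P? ∩? E?) xs! xs!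
                                                                  (P⊆xs ∘ proj₁) (P⊆xs ∘ proj₁) reflection) ⟩
      m + m                                  ≡⟨ cong (m +_) (+-identityʳ m) ⟨
      2 * m                                  ∎
      where
      m : ℕ
      m = length (filter (P? ∩? E?) xs)
      reflection : (P ∩ ∁ E) ⇿ (P ∩ E)
      reflection = record
        { to        = ρ
        ; from      = ρ
        ; to-pres   = λ {x} (p , ¬e) → P-ρ p , proj₂ (ρ-flips x) ¬e
        ; from-pres = λ {x} (p , e) → P-ρ p , proj₁ (ρ-flips x) e
        ; from∘to   = λ _ → ρ∘ρ _
        ; to∘from   = λ _ → ρ∘ρ _
        }

  record Parametrisation (C : Set) {A : Set} (P : Pred A 0ℓ) : Set where
    field
      point             : C → A
      coordinates       : A → C
      coordinates∘point : ∀ c → coordinates (point c) ≡ c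
      covers            : ∀ {x} → P x → ∃ λ c → x ≡ point c

  identity-parametrisation : ∀ {A} {P : Pred A 0ℓ} → Parametrisation A P
  identity-parametrisation = record
    { point = id ; coordinates = id ; coordinates∘point = λ _ → refl ; covers = λ {x} _ → x , refl }

  module _ {C A B : Set} {P : Pred A 0ℓ} {Q : Pred B 0ℓ}
           (φ : Parametrisation C P) (ψ : Parametrisation C Q) where
    private
      module φ = Parametrisation φ
      module ψ = Parametrisation ψ

    parametrised-⇿ : (∀ c → P (φ.point c) → Q (ψ.point c)) →
                     (∀ c → Q (ψ.point c) → P (φ.point c)) → P ⇿ Q
    parametrised-⇿ P⇒Q Q⇒P = record
      { to = ψ.point ∘ φ.coordinates ; from = φ.point ∘ ψ.coordinates
      ; to-pres = to-pres ; from-pres = from-pres ; from∘to = from∘to ; to∘from = to∘from }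
      where
      to-pres : P ⊆ Q ∘ ψ.point ∘ φ.coordinates
      to-pres Px with φ.covers Px
      ... | c , refl rewrite φ.coordinates∘point c = P⇒Q c Px
      from-pres : Q ⊆ P ∘ φ.point ∘ ψ.coordinates
      from-pres Qy with ψ.covers Qy
      ... | c , refl rewrite ψ.coordinates∘point c = Q⇒P c Qy
      from∘to : ∀ {x} → P x → φ.point (ψ.coordinates (ψ.point (φ.coordinates x))) ≡ x
      from∘to Px with φ.covers Px
      ... | c , refl rewrite φ.coordinates∘point c | ψ.coordinates∘point c = refl
      to∘from : ∀ {y} → Q y → ψ.point (φ.coordinates (φ.point (ψ.coordinates y))) ≡ y
      to∘from Qy with ψ.covers Qy
      ... | c , refl rewrite ψ.coordinates∘point c | φ.coordinates∘point c = refl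

module Parity where
  open import Data.Nat.Base using (zero; suc; s≤s)
  open import Data.Nat.Divisibility using (∣1⇒≡1)
  open import Data.Integer.Base using (ℤ; +_; _+_; _-_; _*_)
  open import Data.Integer.DivMod using (_/ℕ_; _%ℕ_; a≡a%ℕn+[a/ℕn]*n; n%ℕd<d)
  open import Data.Integer.Divisibility.Signed using (_∣_; _∣?_; divides; ∣⇒∣ᵤ; ∣m∣n⇒∣m+n; ∣m∣n⇒∣m-n)
  open import Data.Integer.Properties using (+-identityˡ)
  open import Data.Integer.Tactic.RingSolver using (solve-∀)

  Even : Pred ℤ 0ℓ
  Even x = + 2 ∣ x

  even? : Decidable Even
  even? x = + 2 ∣? x

  ¬even-1 : ¬ Even (+ 1)
  ¬even-1 2∣1 with ∣1⇒≡1 (∣⇒∣ᵤ 2∣1)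
  ... | ()

  even-*2 : ∀ x → Even (x * + 2)
  even-*2 x = divides x refl

  ¬even⇒even-pred : ∀ {x} → ¬ Even x → Even (x - + 1)
  ¬even⇒even-pred {x} ¬2∣x with x %ℕ 2 | n%ℕd<d x 2 | a≡a%ℕn+[a/ℕn]*n x 2
  ... | zero        | _            | x≡0+q*2 =
    ⊥-elim (¬2∣x (divides (x /ℕ 2) (trans x≡0+q*2 (+-identityˡ _))))
  ... | suc zero    | _            | x≡1+q*2 =
    divides (x /ℕ 2) (trans (cong (_- + 1) x≡1+q*2) ([1+u]-1≡u (x /ℕ 2 * + 2)))
    where [1+u]-1≡u : ∀ u → + 1 + u - + 1 ≡ u
          [1+u]-1≡u = solve-∀
  ... | suc (suc _) | s≤s (s≤s ()) | _

  [s+t]+[s-t]≡s*2 : ∀ s t → (s + t) + (s - t) ≡ s * + 2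
  [s+t]+[s-t]≡s*2 = solve-∀

  [s+t]-[s-t]≡t*2 : ∀ s t → (s + t) - (s - t) ≡ t * + 2
  [s+t]-[s-t]≡t*2 = solve-∀

  even-sum+diff : ∀ s t → Even ((s + t) + (s - t))
  even-sum+diff s t = divides s ([s+t]+[s-t]≡s*2 s t)

  even-sum⇒sum-diff : ∀ x y → Even (x + y) → ∃₂ λ s d → x ≡ s + d × y ≡ s - d
  even-sum⇒sum-diff x y (divides s x+y≡s*2) = s , x - s , x≡s+[x-s] x s , (begin
    y               ≡⟨ [x+y]-x≡y x y ⟨
    x + y - x       ≡⟨ cong (_- x) x+y≡s*2 ⟩
    s * + 2 - x     ≡⟨ 2s-x≡s-[x-s] x s ⟩
    s - (x - s)     ∎)
    where
    x≡s+[x-s] : ∀ x s → x ≡ s + (x - s)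
    x≡s+[x-s] = solve-∀
    [x+y]-x≡y : ∀ x y → x + y - x ≡ y
    [x+y]-x≡y = solve-∀
    2s-x≡s-[x-s] : ∀ x s → s * + 2 - x ≡ s - (x - s)
    2s-x≡s-[x-s] = solve-∀

  even-pred⇒odd-form : ∀ {d} → Even (d - + 1) → ∃ λ Y → d ≡ Y * + 2 - + 1
  even-pred⇒odd-form {d} (divides q d-1≡q*2) = q + + 1 , (begin
    d                    ≡⟨ d≡[d-1]+1 d ⟩
    d - + 1 + + 1        ≡⟨ cong (_+ + 1) d-1≡q*2 ⟩
    q * + 2 + + 1        ≡⟨ shift q ⟩
    (q + + 1) * + 2 - + 1 ∎)
    where
    d≡[d-1]+1 : ∀ d → d ≡ d - + 1 + + 1
    d≡[d-1]+1 = solve-∀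
    shift : ∀ q → q * + 2 + + 1 ≡ (q + + 1) * + 2 - + 1
    shift = solve-∀

  odd-sum-flip : ∀ {i j} m → i + j ≡ + 1 + m * + 2 → (Even i → ¬ Even j) × (¬ Even i → Even j)
  odd-sum-flip {i} {j} m i+j≡1+2m = even⇒odd , odd⇒even
    where
    [1+2m]-2m≡1 : ∀ m → + 1 + m * + 2 - m * + 2 ≡ + 1
    [1+2m]-2m≡1 = solve-∀
    2m-[i-1]≡[1+2m]-i : ∀ i m → m * + 2 - (i - + 1) ≡ + 1 + m * + 2 - i
    2m-[i-1]≡[1+2m]-i = solve-∀
    [i+j]-i≡j : ∀ i j → i + j - i ≡ j
    [i+j]-i≡j = solve-∀
    even⇒odd : Even i → ¬ Even j
    even⇒odd 2∣i 2∣j = ¬even-1 (subst Even (trans (cong (_- m * + 2) i+j≡1+2m) ([1+2m]-2m≡1 m))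
                                             (∣m∣n⇒∣m-n (∣m∣n⇒∣m+n 2∣i 2∣j) (even-*2 m)))
    odd⇒even : ¬ Even i → Even j
    odd⇒even ¬2∣i = subst Even j-as-difference (∣m∣n⇒∣m-n (even-*2 m) (¬even⇒even-pred ¬2∣i))
      where
      j-as-difference : m * + 2 - (i - + 1) ≡ j
      j-as-difference = begin
        m * + 2 - (i - + 1)  ≡⟨ 2m-[i-1]≡[1+2m]-i i m ⟩
        + 1 + m * + 2 - i    ≡⟨ cong (_- i) i+j≡1+2m ⟨
        i + j - i            ≡⟨ [i+j]-i≡j i j ⟩
        j                    ∎

module TriangularNumbers where
  open import Data.Nat.Base as ℕ using (ℕ; zero; suc; NonZero)
  open import Data.Nat.DivMod using (m*n/n≡m; m*n%n≡0)
  open import Data.Integer.Base using (ℤ; +_; -[1+_]; -_; _+_; _-_; _*_)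
  open import Data.Integer.DivMod using (_/ℕ_)
  open import Data.Integer.Properties using (pos-+; pos-*; *-assoc; *-distribʳ-+; *-cancelʳ-≡)
  open import Data.Integer.Tactic.RingSolver using (solve-∀)

  -- On a negative dividend _/ℕ_ branches on the remainder, which vanishes here.
  m*n/ℕn≡m : ∀ m n .{{_ : NonZero n}} → m * + n /ℕ n ≡ m
  m*n/ℕn≡m (+ m)    n         = trans (cong (_/ℕ n) (sym (pos-* m n))) (cong +_ (m*n/n≡m m n))
  m*n/ℕn≡m -[1+ m ] n@(suc _) rewrite m*n%n≡0 (suc m) n ⦃ _ ⦄ = cong (-_ ∘ +_) (m*n/n≡m (suc m) n)

  triangle : ℕ → ℕ
  triangle zero    = 0
  triangle (suc n) = n ℕ.+ triangle n

  triangle*2≡n*[n-1] : ∀ n → + triangle n * + 2 ≡ + n * (+ n - + 1)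
  triangle*2≡n*[n-1] zero    = refl
  triangle*2≡n*[n-1] (suc n) = begin
    + (n ℕ.+ triangle n) * + 2          ≡⟨ cong (_* + 2) (pos-+ n (triangle n)) ⟩
    (+ n + + triangle n) * + 2          ≡⟨ *-distribʳ-+ (+ 2) (+ n) (+ triangle n) ⟩
    + n * + 2 + + triangle n * + 2      ≡⟨ cong (_+_ (+ n * + 2)) (triangle*2≡n*[n-1] n) ⟩
    + n * + 2 + + n * (+ n - + 1)       ≡⟨ shift (+ n) ⟩
    (+ 1 + + n) * (+ 1 + + n - + 1)     ≡⟨ cong (λ m → m * (m - + 1)) (pos-+ 1 n) ⟨
    + suc n * (+ suc n - + 1)           ∎
    where shift : ∀ m → m * + 2 + m * (m - + 1) ≡ (+ 1 + m) * (+ 1 + m - + 1)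
          shift = solve-∀

  triℕ : ℤ → ℕ
  triℕ (+ n)    = triangle n
  triℕ -[1+ n ] = triangle (suc (suc n))

  x*[x-1]≡triℕ*2 : ∀ x → x * (x - + 1) ≡ + triℕ x * + 2
  x*[x-1]≡triℕ*2 (+ n)    = sym (triangle*2≡n*[n-1] n)
  x*[x-1]≡triℕ*2 -[1+ n ] = begin
    - m * (- m - + 1)                      ≡⟨ negate m ⟩
    (+ 1 + m) * (+ 1 + m - + 1)            ≡⟨ cong (λ m → m * (m - + 1)) (pos-+ 1 (suc n)) ⟨
    + suc (suc n) * (+ suc (suc n) - + 1)  ≡⟨ triangle*2≡n*[n-1] (suc (suc n)) ⟨
    + triangle (suc (suc n)) * + 2         ∎
    where
    m = + suc n
    negate : ∀ m → - m * (- m - + 1) ≡ (+ 1 + m) * (+ 1 + m - + 1)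
    negate = solve-∀

  x≡m*n⇒x/ℕn≡m : ∀ {x} m n .{{_ : NonZero n}} → x ≡ m * + n → x /ℕ n ≡ m
  x≡m*n⇒x/ℕn≡m m n x≡m*n = trans (cong (_/ℕ n) x≡m*n) (m*n/ℕn≡m m n)

  tri≡triℕ : ∀ x → tri x ≡ + triℕ x
  tri≡triℕ x = x≡m*n⇒x/ℕn≡m (+ triℕ x) 2 (x*[x-1]≡triℕ*2 x)

  tri*2≡x*[x-1] : ∀ x → tri x * + 2 ≡ x * (x - + 1)
  tri*2≡x*[x-1] x = trans (cong (_* + 2) (tri≡triℕ x)) (sym (x*[x-1]≡triℕ*2 x))

  tri[1-x]≡tri : ∀ x → tri (+ 1 - x) ≡ tri x
  tri[1-x]≡tri x = *-cancelʳ-≡ _ _ (+ 2) (begin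
    tri (+ 1 - x) * + 2            ≡⟨ tri*2≡x*[x-1] (+ 1 - x) ⟩
    (+ 1 - x) * (+ 1 - x - + 1)    ≡⟨ reflect x ⟩
    x * (x - + 1)                  ≡⟨ tri*2≡x*[x-1] x ⟨
    tri x * + 2                    ∎)
    where reflect : ∀ x → (+ 1 - x) * (+ 1 - x - + 1) ≡ x * (x - + 1)
          reflect = solve-∀

  tri-sum+tri-diff : ∀ u v → tri (u + v) + tri (u - v) ≡ tri u * + 2 + v * v
  tri-sum+tri-diff u v = *-cancelʳ-≡ _ _ (+ 2) (begin
    (tri (u + v) + tri (u - v)) * + 2
      ≡⟨ *-distribʳ-+ (+ 2) (tri (u + v)) (tri (u - v)) ⟩
    tri (u + v) * + 2 + tri (u - v) * + 2
      ≡⟨ cong₂ _+_ (tri*2≡x*[x-1] (u + v)) (tri*2≡x*[x-1] (u - v)) ⟩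
    (u + v) * (u + v - + 1) + (u - v) * (u - v - + 1)
      ≡⟨ parallelogram u v ⟩
    (u * (u - + 1) + v * v) * + 2
      ≡⟨ cong (λ p → (p + v * v) * + 2) (tri*2≡x*[x-1] u) ⟨
    (tri u * + 2 + v * v) * + 2
      ∎)
    where
    parallelogram : ∀ u v → (u + v) * (u + v - + 1) + (u - v) * (u - v - + 1) ≡ (u * (u - + 1) + v * v) * + 2
    parallelogram = solve-∀

  [2y-1]²≡8tri+1 : ∀ y → (y * + 2 - + 1) * (y * + 2 - + 1) ≡ tri y * + 8 + + 1
  [2y-1]²≡8tri+1 y = begin
    (y * + 2 - + 1) * (y * + 2 - + 1)  ≡⟨ square y ⟩
    y * (y - + 1) * + 4 + + 1          ≡⟨ cong (λ p → p * + 4 + + 1) (tri*2≡x*[x-1] y) ⟨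
    tri y * + 2 * + 4 + + 1            ≡⟨ cong (_+ + 1) (*-assoc (tri y) (+ 2) (+ 4)) ⟩
    tri y * + 8 + + 1                  ∎
    where square : ∀ y → (y * + 2 - + 1) * (y * + 2 - + 1) ≡ y * (y - + 1) * + 4 + + 1
          square = solve-∀

module Quadruples where
  open import Data.Nat.Base as ℕ using (ℕ; zero; suc; NonZero; _≤_; z≤n; s≤s)
  open import Data.Nat.Properties using (≤-trans; ≤-reflexive; n≤1+n; m≤m+n; m≤n+m; m≤n*m)
  open import Data.Integer.Base using (ℤ; +_; -[1+_]; _+_; _-_; _*_)
  open import Data.Integer.Properties using (_≟_; pos-+; pos-*; +-injective; -[1+-injective)
  open import Data.Integer.Tactic.RingSolver using (solve-∀)
  open import Data.List using (upTo)
  open import Data.List.Membership.Propositional.Properties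
    using (∈-map⁺; ∈-map⁻; ∈-++⁺ˡ; ∈-++⁺ʳ; ∈-upTo⁺; ∈-cartesianProduct⁺)
  import Data.List.Relation.Unary.Unique.Propositional.Properties as Unique
  open Counting
  open Parity
  open TriangularNumbers

  Quad : Set
  Quad = ℤ × ℤ × ℤ × ℤ

  Solution : ℕ → ℕ → ℕ → ℕ → ℕ → Pred Quad 0ℓ
  Solution a b c d n v = form a b c d v ≡ + n

  solution? : ∀ a b c d n → Decidable (Solution a b c d n)
  solution? a b c d n v = form a b c d v ≟ + n

  count : {P : Pred Quad 0ℓ} → Decidable P → ℕ → ℕ
  count P? N = length (filter P? (box N))

  range-unique : ∀ N → Unique (range N)
  range-unique N = Unique.++⁺ (Unique.map⁺ -[1+-injective (Unique.upTo⁺ N))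
                              (Unique.map⁺ +-injective (Unique.upTo⁺ (suc N))) signs-disjoint
    where
    signs-disjoint : ∀ {v} → ¬ (v ∈ map -[1+_] (upTo N) × v ∈ map +_ (upTo (suc N)))
    signs-disjoint (v∈neg , v∈pos) with ∈-map⁻ -[1+_] v∈neg | ∈-map⁻ +_ v∈pos
    ... | _ , _ , refl | _ , _ , ()

  box-unique : ∀ N → Unique (box N)
  box-unique N = Unique.cartesianProduct⁺ (range-unique N) (Unique.cartesianProduct⁺ (range-unique N)
                   (Unique.cartesianProduct⁺ (range-unique N) (range-unique N)))

  n≤1+triangle : ∀ n → n ≤ suc (triangle n)
  n≤1+triangle zero    = z≤n
  n≤1+triangle (suc n) = s≤s (m≤m+n n (triangle n))

  ∈-range : ∀ {x m} → triℕ x ≤ m → x ∈ range (suc m)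
  ∈-range {+ n}      {m} T≤m = ∈-++⁺ʳ (map -[1+_] (upTo (suc m)))
                                 (∈-map⁺ +_ (∈-upTo⁺ (s≤s (≤-trans (n≤1+triangle n) (s≤s T≤m)))))
  ∈-range { -[1+ n ]}    T≤m = ∈-++⁺ˡ
                                 (∈-map⁺ -[1+_] (∈-upTo⁺ (s≤s (≤-trans (n≤1+n n) (≤-trans (m≤m+n (suc n) _) T≤m)))))

  formℕ : ℕ → ℕ → ℕ → ℕ → Quad → ℕ
  formℕ a b c d (x , y , z , w) = a ℕ.* triℕ x ℕ.+ b ℕ.* triℕ y ℕ.+ c ℕ.* triℕ z ℕ.+ d ℕ.* triℕ w

  form≡formℕ : ∀ a b c d v → form a b c d v ≡ + formℕ a b c d v
  form≡formℕ a b c d (x , y , z , w)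
    rewrite tri≡triℕ x | tri≡triℕ y | tri≡triℕ z | tri≡triℕ w
          | sym (pos-* a (triℕ x)) | sym (pos-* b (triℕ y)) | sym (pos-* c (triℕ z)) | sym (pos-* d (triℕ w))
          | sym (pos-+ (a ℕ.* triℕ x) (b ℕ.* triℕ y))
          | sym (pos-+ (a ℕ.* triℕ x ℕ.+ b ℕ.* triℕ y) (c ℕ.* triℕ z))
          | sym (pos-+ (a ℕ.* triℕ x ℕ.+ b ℕ.* triℕ y ℕ.+ c ℕ.* triℕ z) (d ℕ.* triℕ w)) = refl

  solution∈box : ∀ {a b c d n} .{{_ : NonZero a}} .{{_ : NonZero b}} .{{_ : NonZero c}} .{{_ : NonZero d}} →
                 Solution a b c d n ⊆ (_∈ box (suc n))
  solution∈box {a} {b} {c} {d} {n} {v@(x , y , z , w)} sol =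
    ∈-cartesianProduct⁺ (∈-range (weighted a (≤-trans (m≤m+n X Y) (≤-trans (m≤m+n (X ℕ.+ Y) Z) (m≤m+n _ W)))))
      (∈-cartesianProduct⁺ (∈-range (weighted b (≤-trans (m≤n+m Y X) (≤-trans (m≤m+n (X ℕ.+ Y) Z) (m≤m+n _ W)))))
        (∈-cartesianProduct⁺ (∈-range (weighted c (≤-trans (m≤n+m Z (X ℕ.+ Y)) (m≤m+n _ W))))
          (∈-range (weighted d (m≤n+m W _)))))
    where
    X Y Z W : ℕ
    X = a ℕ.* triℕ x
    Y = b ℕ.* triℕ y
    Z = c ℕ.* triℕ z
    W = d ℕ.* triℕ w
    weighted : ∀ m {t} .{{_ : NonZero m}} → m ℕ.* t ≤ formℕ a b c d v → t ≤ n
    weighted m {t} m*t≤ = ≤-trans (m≤n*m t m)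
                            (≤-trans m*t≤ (≤-reflexive (+-injective (trans (sym (form≡formℕ a b c d v)) sol))))

  count-⇿ : ∀ {P Q : Pred Quad 0ℓ} (P? : Decidable P) (Q? : Decidable Q) M N →
            P ⊆ (_∈ box M) → Q ⊆ (_∈ box N) → P ⇿ Q → count P? M ≡ count Q? N
  count-⇿ P? Q? M N = length-filter-⇿ P? Q? (box-unique M) (box-unique N)

  reflect₂ : Quad → Quad
  reflect₂ (x , y , z , w) = x , + 1 - y , z , w

  reflect₂-involutive : ∀ v → reflect₂ (reflect₂ v) ≡ v
  reflect₂-involutive (x , y , z , w) = cong (λ y′ → x , y′ , z , w) (1-[1-y]≡y y)
    where 1-[1-y]≡y : ∀ y → + 1 - (+ 1 - y) ≡ y
          1-[1-y]≡y = solve-∀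

  form-reflect₂ : ∀ a b c d v → form a b c d (reflect₂ v) ≡ form a b c d v
  form-reflect₂ a b c d (x , y , z , w) =
    cong (λ t → + a * tri x + + b * t + + c * tri z + + d * tri w) (tri[1-x]≡tri y)

  t≡2*count : ∀ a b c d n .{{_ : NonZero a}} .{{_ : NonZero b}} .{{_ : NonZero c}} .{{_ : NonZero d}}
              {E} (E? : Decidable E) → Flips reflect₂ E →
              t a b c d n ≡ 2 ℕ.* count (solution? a b c d n ∩? E?) (suc n)
  t≡2*count a b c d n E? = length-filter-halves (solution? a b c d n) E? (box-unique (suc n)) solution∈box
                             reflect₂ reflect₂-involutive (λ {v} → trans (form-reflect₂ a b c d v))

  Even₁₂ Even₂₃ : Pred Quad 0ℓ
  Even₁₂ (x , y , _ , _) = Even (x + y)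
  Even₂₃ (_ , y , z , _) = Even (y + z)

  even₁₂? : Decidable Even₁₂
  even₁₂? (x , y , _ , _) = even? (x + y)

  even₂₃? : Decidable Even₂₃
  even₂₃? (_ , y , z , _) = even? (y + z)

  reflect₂-flips-Even₁₂ : Flips reflect₂ Even₁₂
  reflect₂-flips-Even₁₂ (x , y , _ , _) = odd-sum-flip x ([x+y]+[x+1-y]≡1+2x x y)
    where [x+y]+[x+1-y]≡1+2x : ∀ x y → x + y + (x + (+ 1 - y)) ≡ + 1 + x * + 2
          [x+y]+[x+1-y]≡1+2x = solve-∀

  reflect₂-flips-Even₂₃ : Flips reflect₂ Even₂₃
  reflect₂-flips-Even₂₃ (_ , y , z , _) = odd-sum-flip z ([y+z]+[1-y+z]≡1+2z y z)
    where [y+z]+[1-y+z]≡1+2z : ∀ y z → y + z + (+ 1 - y + z) ≡ + 1 + z * + 2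
          [y+z]+[1-y+z]≡1+2z = solve-∀


module Correspondences (a k : ℕ) (a≢0 : NonZero a) (k≢0 : NonZero k) (a-odd : ¬ Parity.Even (ℤ.+ a)) where
  open import Data.Nat.Base as ℕ using (suc)
  open import Data.Nat.Properties using (m*n≢0)
  open import Data.Integer.Base using (ℤ; +_; _+_; _-_; _*_)
  open import Data.Integer.DivMod using (_/ℕ_)
  open import Data.Integer.Divisibility.Signed using (divides; ∣m∣n⇒∣m+n; ∣m∣n⇒∣m-n; ∣m⇒∣m*n)
  open import Data.Integer.Properties using (pos-+; pos-*; *-comm; *-assoc; *-cancelʳ-≡; +-0-abelianGroup)
  open import Algebra.Properties.AbelianGroup +-0-abelianGroup using (∙-cancelʳ)
  open import Data.Integer.Tactic.RingSolver using (solve-∀)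
  open Counting
  open Parity
  open TriangularNumbers
  open Quadruples

  instance
    a-nonZero : NonZero a
    a-nonZero = a≢0
    k-nonZero : NonZero k
    k-nonZero = k≢0
    2a-nonZero : NonZero (2 ℕ.* a)
    2a-nonZero = m*n≢0 2 a
    4a-nonZero : NonZero (4 ℕ.* a)
    4a-nonZero = m*n≢0 4 a
    8a-nonZero : NonZero (8 ℕ.* a)
    8a-nonZero = m*n≢0 8 a
    2k-nonZero : NonZero (2 ℕ.* k)
    2k-nonZero = m*n≢0 2 k

  A K : ℤ
  A = + a
  K = + k

  L : Quad → ℤ
  L = form a a (8 ℕ.* a) (2 ℕ.* k)

  R : ℕ → Quad → ℤ
  R m = form a (m ℕ.* a) (m ℕ.* a) k

  +[2n]≡n*2 : ∀ n → + (2 ℕ.* n) ≡ + n * + 2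
  +[2n]≡n*2 n = trans (pos-* 2 n) (*-comm (+ 2) (+ n))

  +[2n+a]≡n*2+a : ∀ n → + (2 ℕ.* n ℕ.+ a) ≡ + n * + 2 + A
  +[2n+a]≡n*2+a n = trans (pos-+ (2 ℕ.* n) a) (cong (_+ A) (+[2n]≡n*2 n))

  L-sum-diff : ∀ s d z w →
               L (s + d , s - d , z , w) ≡ A * (d * d) + (A * tri s + + 4 * A * tri z + K * tri w) * + 2
  L-sum-diff s d z w = begin
    A * tri (s + d) + A * tri (s - d) + + (8 ℕ.* a) * tri z + + (2 ℕ.* k) * tri w
      ≡⟨ cong₂ (λ p q → A * tri (s + d) + A * tri (s - d) + p * tri z + q * tri w) (pos-* 8 a) (pos-* 2 k) ⟩
    A * tri (s + d) + A * tri (s - d) + + 8 * A * tri z + + 2 * K * tri w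
      ≡⟨ factor A K (tri (s + d)) (tri (s - d)) (tri z) (tri w) ⟩
    A * (tri (s + d) + tri (s - d)) + (+ 4 * A * tri z + K * tri w) * + 2
      ≡⟨ cong (λ p → A * p + (+ 4 * A * tri z + K * tri w) * + 2) (tri-sum+tri-diff s d) ⟩
    A * (tri s * + 2 + d * d) + (+ 4 * A * tri z + K * tri w) * + 2
      ≡⟨ regroup A K (tri s) (tri z) (tri w) d ⟩
    A * (d * d) + (A * tri s + + 4 * A * tri z + K * tri w) * + 2
      ∎
    where
    factor : ∀ A K p q r u →
             A * p + A * q + + 8 * A * r + + 2 * K * u ≡ A * (p + q) + (+ 4 * A * r + K * u) * + 2
    factor = solve-∀
    regroup : ∀ A K p r u d →
              A * (p * + 2 + d * d) + (+ 4 * A * r + K * u) * + 2 ≡ A * (d * d) + (A * p + + 4 * A * r + K * u) * + 2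
    regroup = solve-∀

  R-expand : ∀ m X Y Z W → R m (X , Y , Z , W) ≡ A * tri X + + m * A * (tri Y + tri Z) + K * tri W
  R-expand m X Y Z W = trans (cong (λ p → A * tri X + p * tri Y + p * tri Z + K * tri W) (pos-* m a))
                             (factor A (+ m) K (tri X) (tri Y) (tri Z) (tri W))
    where
    factor : ∀ A M K p q r u → A * p + M * A * q + M * A * r + K * u ≡ A * p + M * A * (q + r) + K * u
    factor = solve-∀

  L≡R₁*2 : ∀ s e z w → L (s + e * + 2 , s - e * + 2 , z , w) ≡ R 2 (s , z + e , z - e , w) * + 2
  L≡R₁*2 s e z w = begin
    L (s + e * + 2 , s - e * + 2 , z , w)
      ≡⟨ L-sum-diff s (e * + 2) z w ⟩
    A * (e * + 2 * (e * + 2)) + (A * tri s + + 4 * A * tri z + K * tri w) * + 2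
      ≡⟨ regroup A K (tri s) (tri z) (tri w) e ⟩
    (A * tri s + + 2 * A * (tri z * + 2 + e * e) + K * tri w) * + 2
      ≡⟨ cong (λ p → (A * tri s + + 2 * A * p + K * tri w) * + 2) (tri-sum+tri-diff z e) ⟨
    (A * tri s + + 2 * A * (tri (z + e) + tri (z - e)) + K * tri w) * + 2
      ≡⟨ cong (_* + 2) (R-expand 2 s (z + e) (z - e) w) ⟨
    R 2 (s , z + e , z - e , w) * + 2
      ∎
    where
    regroup : ∀ A K p r u e → A * (e * + 2 * (e * + 2)) + (A * p + + 4 * A * r + K * u) * + 2
                            ≡ (A * p + + 2 * A * (r * + 2 + e * e) + K * u) * + 2
    regroup = solve-∀

  L≡R₂*2+a : ∀ X Y Z W →
             L (X + (Y * + 2 - + 1) , X - (Y * + 2 - + 1) , Z , W) ≡ R 4 (X , Y , Z , W) * + 2 + A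
  L≡R₂*2+a X Y Z W = begin
    L (X + (Y * + 2 - + 1) , X - (Y * + 2 - + 1) , Z , W)
      ≡⟨ L-sum-diff X (Y * + 2 - + 1) Z W ⟩
    A * ((Y * + 2 - + 1) * (Y * + 2 - + 1)) + (A * tri X + + 4 * A * tri Z + K * tri W) * + 2
      ≡⟨ cong (λ p → A * p + (A * tri X + + 4 * A * tri Z + K * tri W) * + 2) ([2y-1]²≡8tri+1 Y) ⟩
    A * (tri Y * + 8 + + 1) + (A * tri X + + 4 * A * tri Z + K * tri W) * + 2
      ≡⟨ regroup A K (tri X) (tri Y) (tri Z) (tri W) ⟩
    (A * tri X + + 4 * A * (tri Y + tri Z) + K * tri W) * + 2 + A
      ≡⟨ cong (λ p → p * + 2 + A) (R-expand 4 X Y Z W) ⟨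
    R 4 (X , Y , Z , W) * + 2 + A
      ∎
    where
    regroup : ∀ A K p q r u → A * (q * + 8 + + 1) + (A * p + + 4 * A * r + K * u) * + 2
                            ≡ (A * p + + 4 * A * (q + r) + K * u) * + 2 + A
    regroup = solve-∀

  L-sum-diff-parity : ∀ s d z w → Even (L (s + d , s - d , z , w) - d)
  L-sum-diff-parity s d z w = subst Even (sym decomposition)
    (∣m∣n⇒∣m+n (∣m∣n⇒∣m+n (∣m⇒∣m*n (d * d) (¬even⇒even-pred a-odd))
                          (divides (tri d) (sym (tri*2≡x*[x-1] d))))
               (even-*2 M))
    where
    M : ℤ
    M = A * tri s + + 4 * A * tri z + K * tri w
    rearrange : ∀ A d M → A * (d * d) + M * + 2 - d ≡ (A - + 1) * (d * d) + d * (d - + 1) + M * + 2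
    rearrange = solve-∀
    decomposition : L (s + d , s - d , z , w) - d ≡ (A - + 1) * (d * d) + d * (d - + 1) + M * + 2
    decomposition = trans (cong (_- d) (L-sum-diff s d z w)) (rearrange A d M)

  L≡2n⇒even-gap : ∀ s d z w n → L (s + d , s - d , z , w) ≡ + (2 ℕ.* n) → Even d
  L≡2n⇒even-gap s d z w n L≡2n = subst Even (N-[N-d]≡d (+ n * + 2) d)
    (∣m∣n⇒∣m-n (even-*2 (+ n))
               (subst (λ l → Even (l - d)) (trans L≡2n (+[2n]≡n*2 n)) (L-sum-diff-parity s d z w)))
    where
    N-[N-d]≡d : ∀ N d → N - (N - d) ≡ d
    N-[N-d]≡d = solve-∀

  L≡2n+a⇒odd-gap : ∀ s d z w n → L (s + d , s - d , z , w) ≡ + (2 ℕ.* n ℕ.+ a) →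
                   ∃ λ Y → d ≡ Y * + 2 - + 1
  L≡2n+a⇒odd-gap s d z w n L≡2n+a = even-pred⇒odd-form (subst Even (d-1-as-difference (+ n) A d)
    (∣m∣n⇒∣m-n (∣m∣n⇒∣m+n (even-*2 (+ n)) (¬even⇒even-pred a-odd))
               (subst (λ l → Even (l - d)) (trans L≡2n+a (+[2n+a]≡n*2+a n)) (L-sum-diff-parity s d z w))))
    where
    d-1-as-difference : ∀ n A d → n * + 2 + (A - + 1) - (n * + 2 + A - d) ≡ d - + 1
    d-1-as-difference = solve-∀

  sum-diff-form : ∀ {x y d} s d′ z w → x ≡ s + d → y ≡ s - d → d ≡ d′ →
                  _≡_ {A = Quad} (x , y , z , w) (s + d′ , s - d′ , z , w)
  sum-diff-form s d′ z w refl refl refl = refl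

  halve-value : ∀ {l r} n → l ≡ r * + 2 → l ≡ + (2 ℕ.* n) → r ≡ + n
  halve-value n l≡r*2 l≡2n = *-cancelʳ-≡ _ _ (+ 2) (trans (sym l≡r*2) (trans l≡2n (+[2n]≡n*2 n)))

  double-value : ∀ {l r} n → l ≡ r * + 2 → r ≡ + n → l ≡ + (2 ℕ.* n)
  double-value n l≡r*2 r≡n = trans l≡r*2 (trans (cong (_* + 2) r≡n) (sym (+[2n]≡n*2 n)))

  halve-odd-value : ∀ {l r} n → l ≡ r * + 2 + A → l ≡ + (2 ℕ.* n ℕ.+ a) → r ≡ + n
  halve-odd-value n l≡r*2+a l≡2n+a =
    *-cancelʳ-≡ _ _ (+ 2) (∙-cancelʳ A _ _ (trans (sym l≡r*2+a) (trans l≡2n+a (+[2n+a]≡n*2+a n))))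

  double-odd-value : ∀ {l r} n → l ≡ r * + 2 + A → r ≡ + n → l ≡ + (2 ℕ.* n ℕ.+ a)
  double-odd-value n l≡r*2+a r≡n =
    trans l≡r*2+a (trans (cong (λ r → r * + 2 + A) r≡n) (sym (+[2n+a]≡n*2+a n)))

  L[2n]-param : ∀ n → Parametrisation Quad (Solution a a (8 ℕ.* a) (2 ℕ.* k) (2 ℕ.* n) ∩ Even₁₂)
  L[2n]-param n = record
    { point = point ; coordinates = coordinates ; coordinates∘point = coordinates∘point ; covers = covers }
    where
    point : Quad → Quad
    point (s , e , z , w) = s + e * + 2 , s - e * + 2 , z , w
    coordinates : Quad → Quad
    coordinates (x , y , z , w) = (x + y) /ℕ 2 , (x - y) /ℕ 4 , z , w
    coordinates∘point : ∀ c → coordinates (point c) ≡ c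
    coordinates∘point (s , e , z , w) = cong₂ (λ s′ e′ → s′ , e′ , z , w)
      (x≡m*n⇒x/ℕn≡m s 2 ([s+t]+[s-t]≡s*2 s (e * + 2)))
      (x≡m*n⇒x/ℕn≡m e 4 (trans ([s+t]-[s-t]≡t*2 s (e * + 2)) (*-assoc e (+ 2) (+ 2))))
    covers : ∀ {v} → (Solution a a (8 ℕ.* a) (2 ℕ.* k) (2 ℕ.* n) ∩ Even₁₂) v → ∃ λ c → v ≡ point c
    covers {x , y , z , w} (sol , x+y-even) =
      let s , d , x≡s+d , y≡s-d = even-sum⇒sum-diff x y x+y-even
          divides e d≡e*2 = L≡2n⇒even-gap s d z w n
                              (subst₂ (λ x y → L (x , y , z , w) ≡ + (2 ℕ.* n)) x≡s+d y≡s-d sol)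
      in (s , e , z , w) , sum-diff-form s (e * + 2) z w x≡s+d y≡s-d d≡e*2

  R₁[n]-param : ∀ n → Parametrisation Quad (Solution a (2 ℕ.* a) (2 ℕ.* a) k n ∩ Even₂₃)
  R₁[n]-param n = record
    { point = point ; coordinates = coordinates ; coordinates∘point = coordinates∘point ; covers = covers }
    where
    point : Quad → Quad
    point (s , e , z , w) = s , z + e , z - e , w
    coordinates : Quad → Quad
    coordinates (X , Y , Z , W) = X , (Y - Z) /ℕ 2 , (Y + Z) /ℕ 2 , W
    coordinates∘point : ∀ c → coordinates (point c) ≡ c
    coordinates∘point (s , e , z , w) = cong₂ (λ e′ z′ → s , e′ , z′ , w)
      (x≡m*n⇒x/ℕn≡m e 2 ([s+t]-[s-t]≡t*2 z e))
      (x≡m*n⇒x/ℕn≡m z 2 ([s+t]+[s-t]≡s*2 z e))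
    covers : ∀ {v} → (Solution a (2 ℕ.* a) (2 ℕ.* a) k n ∩ Even₂₃) v → ∃ λ c → v ≡ point c
    covers {X , Y , Z , W} (_ , Y+Z-even) =
      let z , e , Y≡z+e , Z≡z-e = even-sum⇒sum-diff Y Z Y+Z-even
      in (X , e , z , W) , cong₂ (λ Y Z → X , Y , Z , W) Y≡z+e Z≡z-e

  L[2n+a]-param : ∀ n → Parametrisation Quad (Solution a a (8 ℕ.* a) (2 ℕ.* k) (2 ℕ.* n ℕ.+ a) ∩ Even₁₂)
  L[2n+a]-param n = record
    { point = point ; coordinates = coordinates ; coordinates∘point = coordinates∘point ; covers = covers }
    where
    point : Quad → Quad
    point (X , Y , Z , W) = X + (Y * + 2 - + 1) , X - (Y * + 2 - + 1) , Z , W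
    coordinates : Quad → Quad
    coordinates (x , y , z , w) = (x + y) /ℕ 2 , (x - y + + 2) /ℕ 4 , z , w
    [X+d]-[X-d]+2≡Y*4 : ∀ X Y → X + (Y * + 2 - + 1) - (X - (Y * + 2 - + 1)) + + 2 ≡ Y * + 4
    [X+d]-[X-d]+2≡Y*4 = solve-∀
    coordinates∘point : ∀ c → coordinates (point c) ≡ c
    coordinates∘point (X , Y , Z , W) = cong₂ (λ X′ Y′ → X′ , Y′ , Z , W)
      (x≡m*n⇒x/ℕn≡m X 2 ([s+t]+[s-t]≡s*2 X (Y * + 2 - + 1)))
      (x≡m*n⇒x/ℕn≡m Y 4 ([X+d]-[X-d]+2≡Y*4 X Y))
    covers : ∀ {v} → (Solution a a (8 ℕ.* a) (2 ℕ.* k) (2 ℕ.* n ℕ.+ a) ∩ Even₁₂) v → ∃ λ c → v ≡ point c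
    covers {x , y , z , w} (sol , x+y-even) =
      let s , d , x≡s+d , y≡s-d = even-sum⇒sum-diff x y x+y-even
          Y , d≡2Y-1 = L≡2n+a⇒odd-gap s d z w n
                         (subst₂ (λ x y → L (x , y , z , w) ≡ + (2 ℕ.* n ℕ.+ a)) x≡s+d y≡s-d sol)
      in (s , Y , z , w) , sum-diff-form s (Y * + 2 - + 1) z w x≡s+d y≡s-d d≡2Y-1

  L[2n]⇿R₁[n] : ∀ n → (Solution a a (8 ℕ.* a) (2 ℕ.* k) (2 ℕ.* n) ∩ Even₁₂)
                    ⇿ (Solution a (2 ℕ.* a) (2 ℕ.* a) k n ∩ Even₂₃)
  L[2n]⇿R₁[n] n = parametrised-⇿ (L[2n]-param n) (R₁[n]-param n)
    (λ (s , e , z , w) (sol , _) → halve-value n (L≡R₁*2 s e z w) sol , even-sum+diff z e)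
    (λ (s , e , z , w) (sol , _) → double-value n (L≡R₁*2 s e z w) sol , even-sum+diff s (e * + 2))

  L[2n+a]⇿R₂[n] : ∀ n → (Solution a a (8 ℕ.* a) (2 ℕ.* k) (2 ℕ.* n ℕ.+ a) ∩ Even₁₂)
                      ⇿ Solution a (4 ℕ.* a) (4 ℕ.* a) k n
  L[2n+a]⇿R₂[n] n = parametrised-⇿ (L[2n+a]-param n) identity-parametrisation
    (λ (X , Y , Z , W) (sol , _) → halve-odd-value n (L≡R₂*2+a X Y Z W) sol)
    (λ (X , Y , Z , W) sol → double-odd-value n (L≡R₂*2+a X Y Z W) sol , even-sum+diff X (Y * + 2 - + 1))

  L-even? : ∀ m → Decidable (Solution a a (8 ℕ.* a) (2 ℕ.* k) m ∩ Even₁₂)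
  L-even? m = solution? a a (8 ℕ.* a) (2 ℕ.* k) m ∩? even₁₂?

  R₁-even? : ∀ n → Decidable (Solution a (2 ℕ.* a) (2 ℕ.* a) k n ∩ Even₂₃)
  R₁-even? n = solution? a (2 ℕ.* a) (2 ℕ.* a) k n ∩? even₂₃?

  count-L[2n]≡count-R₁[n] : ∀ n →
                            count (L-even? (2 ℕ.* n)) (suc (2 ℕ.* n)) ≡ count (R₁-even? n) (suc n)
  count-L[2n]≡count-R₁[n] n = count-⇿ (L-even? (2 ℕ.* n)) (R₁-even? n) (suc (2 ℕ.* n)) (suc n)
    (solution∈box ∘ proj₁) (solution∈box ∘ proj₁) (L[2n]⇿R₁[n] n)

  count-L[2n+a]≡t-R₂[n] : ∀ n →
                          count (L-even? (2 ℕ.* n ℕ.+ a)) (suc (2 ℕ.* n ℕ.+ a)) ≡ t a (4 ℕ.* a) (4 ℕ.* a) k n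
  count-L[2n+a]≡t-R₂[n] n =
    count-⇿ (L-even? (2 ℕ.* n ℕ.+ a)) (solution? a (4 ℕ.* a) (4 ℕ.* a) k n) (suc (2 ℕ.* n ℕ.+ a)) (suc n)
            (solution∈box ∘ proj₁) solution∈box (L[2n+a]⇿R₂[n] n)

open import Data.Nat.Base using (suc; _+_; _*_)
open import Data.Nat.Divisibility using (_∣_)
open import Data.Integer.Divisibility.Signed using (∣⇒∣ᵤ)
open Quadruples

theorem2p7 : (a k : ℕ) → NonZero a → NonZero k → ¬ (2 ∣ a) →
    (n : ℕ) → NonZero n →
    (t a a (8 * a) (2 * k) (2 * n) ≡ t a (2 * a) (2 * a) k n)
    × (t a a (8 * a) (2 * k) (2 * n + a) ≡ 2 * t a (4 * a) (4 * a) k n)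
theorem2p7 a k a≢0 k≢0 a-odd n _ = even-values , odd-values
  where
  open Correspondences a k a≢0 k≢0 (a-odd ∘ ∣⇒∣ᵤ)
  even-values : t a a (8 * a) (2 * k) (2 * n) ≡ t a (2 * a) (2 * a) k n
  even-values = begin
    t a a (8 * a) (2 * k) (2 * n)
      ≡⟨ t≡2*count a a (8 * a) (2 * k) (2 * n) even₁₂? reflect₂-flips-Even₁₂ ⟩
    2 * count (L-even? (2 * n)) (suc (2 * n))
      ≡⟨ cong (2 *_) (count-L[2n]≡count-R₁[n] n) ⟩
    2 * count (R₁-even? n) (suc n)
      ≡⟨ t≡2*count a (2 * a) (2 * a) k n even₂₃? reflect₂-flips-Even₂₃ ⟨
    t a (2 * a) (2 * a) k n
      ∎
  odd-values : t a a (8 * a) (2 * k) (2 * n + a) ≡ 2 * t a (4 * a) (4 * a) k n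
  odd-values = begin
    t a a (8 * a) (2 * k) (2 * n + a)
      ≡⟨ t≡2*count a a (8 * a) (2 * k) (2 * n + a) even₁₂? reflect₂-flips-Even₁₂ ⟩
    2 * count (L-even? (2 * n + a)) (suc (2 * n + a))
      ≡⟨ cong (2 *_) (count-L[2n+a]≡t-R₂[n] n) ⟩
    2 * t a (4 * a) (4 * a) k n
      ∎
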